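{- In the setting described in the context, for $1\le i'\le i\le t$ we have $J_{i'}\subseteq J_i$.
   Context: Fix $r\geq 1$. For a graph $G$, $\mathrm{Con}_r(G)$ is the hypergraph on $V(G)$ whose edges are the subsets $S\subseteq V(G)$ with $|S|=r+1$ and $G[S]$ connected; a vertex cover of a hypergraph is a set of vertices meeting every edge, and a minimal vertex cover is one minimal under inclusion. Let $CG$ be a caterpillar graph: a tree with a path $\alpha_1-\alpha_2-\cdots-\alpha_l$ (the $\alpha_i$ being its internal vertices, $\alpha_i$ adjacent to $\alpha_{i-1},\alpha_{i+1}$) such that every other vertex is a leaf adjacent to exactly one $\alpha_i$. Fix $1\le t\le l$. For $i\neq t$ the leaves adjacent to $\alpha_i$ are $\beta_{i,1},\dots,\beta_{i,m_i}$ ($m_i\geq 0$), and the leaves adjacent to $\alpha_t$ are $\beta_{t,1},\dots,\beta_{t,m_t},\dots,\beta_{t,m_t'}$ with $m_t\le m_t'$. Assume $r+1=t+\sum_{i=1}^t m_i$. Let $R=\mathbb{K}[x_\theta:\theta\in V(CG)]$ over a field $\mathbb K$, and for $F\subseteq V(CG)$ put $\mathbf{x}_F=\prod_{\theta\in F}x_\theta$. For $1\le i\le t$ let $A_i$ be the set of minimal vertex covers $\mathcal C$ of $\mathrm{Con}_r(CG)$ with $\alpha_i\in\mathcal C$ and $\alpha_j,\beta_{j,1},\dots,\beta_{j,m_j}\notin\mathcal C$ for all $1\le j\le i-1$, and let $J_i=\langle \mathbf{x}_{\mathcal C\setminus\{\alpha_i\}}:\mathcal C\in A_i\rangle\subseteq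 R$. -}

module Defs where

open import Level using (Level; _⊔_) renaming (suc to lsuc)
open import Data.Nat using (ℕ; zero; suc; _+_; _≤_; _<_; _<ᵇ_; _≡ᵇ_)
open import Data.Fin using (Fin; toℕ) renaming (_≟_ to _≟ᶠ_)
open import Data.List using (List; []; _∷_; _++_; map; concatMap; foldr; length; filterᵇ; allFin)
open import Data.Nat.ListAction using (sum)
import Data.Nat as ℕ
open import Data.List.Relation.Unary.All using (All)
open import Data.Bool using (Bool; true; false; _∧_; not; if_then_else_)
open import Data.Product using (Σ; ∃; _×_; _,_; proj₁; proj₂)
open import Data.Sum using (_⊎_)
open import Relation.Nullary using (¬_; does)
open import Relation.Binary.PropositionalEquality using (_≡_)
open import Algebra.Bundles using (CommutativeRing)

record Field (c ℓ : Level) : Set (lsuc (c ⊔ ℓ)) where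
  field
    commRing : CommutativeRing c ℓ
  open CommutativeRing commRing public
  field
    1≉0      : ¬ (1# ≈ 0#)
    inverse  : ∀ x → ¬ (x ≈ 0#) → Σ Carrier λ y → (x * y) ≈ 1#

-- The caterpillar graph CG with spine α_0 - α_1 - ... - α_{l-1}
-- (0-based indices) and M i leaves β_{i,0},...,β_{i,M i - 1} at α_i.

module Caterpillar (l : ℕ) (M : Fin l → ℕ) where

  data Vertex : Set where
    α : Fin l → Vertex
    β : (i : Fin l) → Fin (M i) → Vertex

  -- one orientation of each edge of CG
  data Edge : Vertex → Vertex → Set where
    spine : (i j : Fin l) → toℕ j ≡ suc (toℕ i) → Edge (α i) (α j)
    leaf  : (i : Fin l) (k : Fin (M i)) → Edge (α i) (β i k)

  Adj : Vertex → Vertex → Set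
  Adj u v = Edge u v ⊎ Edge v u

  allVertices : List Vertex
  allVertices = concatMap (λ i → α i ∷ map (β i) (allFin (M i))) (allFin l)

  VSet : Set
  VSet = Vertex → Bool

  _∈ₛ_ : Vertex → VSet → Set
  v ∈ₛ S = S v ≡ true

  _⊆ₛ_ : VSet → VSet → Set
  S ⊆ₛ T = ∀ v → v ∈ₛ S → v ∈ₛ T

  ∣_∣ₛ : VSet → ℕ
  ∣ S ∣ₛ = length (filterᵇ S allVertices)

  data Walk (S : VSet) : Vertex → Vertex → Set where
    here : ∀ {u} → Walk S u u
    step : ∀ {u v w} → Adj u v → v ∈ₛ S → Walk S v w → Walk S u w

  Connected : VSet → Set
  Connected S = ∀ u v → u ∈ₛ S → v ∈ₛ S → Walk S u v

  ConEdge : ℕ → VSet → Set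
  ConEdge r S = (∣ S ∣ₛ ≡ suc r) × Connected S

  IsVertexCover : ℕ → VSet → Set
  IsVertexCover r C = ∀ S → ConEdge r S → ∃ λ v → v ∈ₛ S × v ∈ₛ C

  IsMinimalVertexCover : ℕ → VSet → Set
  IsMinimalVertexCover r C =
    IsVertexCover r C × (∀ C' → C' ⊆ₛ C → IsVertexCover r C' → C ⊆ₛ C')

  -- A_i (0-based i)
  A : ℕ → Fin l → VSet → Set
  A r i C = IsMinimalVertexCover r C × α i ∈ₛ C
          × (∀ j → toℕ j < toℕ i → (C (α j) ≡ false) × (∀ k → C (β j k) ≡ false))

  removeα : VSet → Fin l → VSet
  removeα C i (α j)   = C (α j) ∧ not (does (i ≟ᶠ j))
  removeα C i (β j k) = C (β j k)

  sumBefore : Fin l → ℕ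
  sumBefore t = sum (map (λ j → if toℕ j <ᵇ toℕ t then M j else 0) (allFin l))

  -- The polynomial ring R = K[x_θ : θ ∈ V(CG)]: finite formal sums of
  -- coefficient·monomial, monomials being exponent vectors, with two
  -- polynomials equal iff all coefficients agree.

  Mono : Set
  Mono = Vertex → ℕ

  _≟ₘ_ : Mono → Mono → Bool
  μ ≟ₘ ν = foldr (λ v b → (μ v ≡ᵇ ν v) ∧ b) true allVertices

  indicator : VSet → Mono
  indicator F v = if F v then 1 else 0

  module PolyRing {c ℓ} (K : Field c ℓ) where
    open Field K hiding (_+_)
    open Field K using () renaming (_+_ to _+ᴷ_)

    Poly : Set c
    Poly = List (Carrier × Mono)

    coeff : Poly → Mono → Carrier
    coeff p μ = foldr (λ t acc → if proj₂ t ≟ₘ μ then proj₁ t +ᴷ acc else acc) 0# p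

    _≈ₚ_ : Poly → Poly → Set ℓ
    p ≈ₚ q = ∀ μ → coeff p μ ≈ coeff q μ

    _+ₚ_ : Poly → Poly → Poly
    p +ₚ q = p ++ q

    _*ₚ_ : Poly → Poly → Poly
    p *ₚ q = concatMap (λ s → map (λ t → (proj₁ s * proj₁ t , λ v → proj₂ s v + proj₂ t v)) q) p

    sumₚ : List Poly → Poly
    sumₚ = foldr _+ₚ_ []

    x[_] : VSet → Poly
    x[ F ] = (1# , indicator F) ∷ []

    _∈⟨_⟩ : Poly → (VSet → Set) → Set (c ⊔ ℓ)
    f ∈⟨ Gen ⟩ = ∃ λ (gs : List (Poly × VSet)) →
      All (λ g → Gen (proj₂ g)) gs × (f ≈ₚ sumₚ (map (λ g → proj₁ g *ₚ x[ proj₂ g ]) gs))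

    JGen : ℕ → Fin l → VSet → Set
    JGen r i F = ∃ λ C → A r i C × (∀ v → F v ≡ removeα C i v)

    _∈J[_,_] : Poly → ℕ → Fin l → Set (c ⊔ ℓ)
    f ∈J[ r , i ] = f ∈⟨ JGen r i ⟩

-- Let C ∈ A_{i'} with i' < i ≤ t, and put D = {α_i} ∪ {v ∈ C | v lies at or right of α_i}.
-- D is still a vertex cover of Con_r(CG): an edge S met by C only to the left of α_i and
-- not containing α_i is connected, so it lies entirely left of α_i, where there are at
-- most t + Σ_{j<t} m_j < r + 1 vertices. Covering is decidable, so greedily discarding
-- vertices of D yields a minimal cover C' ⊆ D. It contains α_i, since otherwise C' ⊆ C
-- and the minimality of C would put α_{i'} into C' ⊆ D. Hence C' ∈ A_i, and
-- C' ∖ {α_i} ⊆ C ∖ {α_{i'}}: every generator of J_{i'} is a multiple of one of J_i.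

module Submission where

open import Defs
open import Level using (_⊔_)
open import Data.Bool using (Bool; true; false; _∧_; _∨_; not; if_then_else_)
open import Data.Bool.Properties using (∧-zeroʳ; ∨-zeroʳ; T-≡; ¬-not) renaming (_≟_ to _≟ᵇ_)
open import Data.Empty using (⊥-elim)
open import Data.Fin using (Fin; zero; suc; toℕ) renaming (_≟_ to _≟ᶠ_)
open import Data.Fin.Properties using (toℕ-injective)
open import Data.List using (List; []; _∷_; _++_; map; concatMap; length; filterᵇ; allFin; tabulate)
open import Data.List.Membership.Propositional.Properties using (∈-allFin; ∈-map⁺; ∈-concatMap⁺)
open import Data.List.Membership.Propositional using (_∈_)
open import Data.List.Properties using (filter-++; length-++; length-tabulate; map-cong; map-tabulate; foldr-cong)
open import Data.List.Relation.Unary.All as All using (All; []; _∷_; all?)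
open import Data.List.Relation.Binary.Pointwise using (Pointwise; []; _∷_; ++⁺)
open import Data.List.Relation.Unary.Any as Any using (here; there; any?)
open import Data.Nat using (ℕ; zero; suc; _+_; _≤_; _<_; z≤n; s≤s; _<ᵇ_; _≡ᵇ_; _≤?_)
open import Data.Nat.ListAction using (sum)
open import Data.Nat.Properties
  using ( ≤-refl; ≤-reflexive; ≤-trans; ≤-antisym; ≤-pred; <-trans; <-≤-trans; <-irrefl; <⇒≱; ≰⇒>
        ; 1+n≰n; n<1+n; m≤n⇒m≤1+n; m≤n⇒m<n∨m≡n; m≤m+n; suc-injective; <⇒<ᵇ
        ; +-assoc; +-monoʳ-≤; +-commutativeSemigroup; module ≤-Reasoning )
  renaming (_≟_ to _≟ℕ_)
open import Algebra.Properties.CommutativeSemigroup +-commutativeSemigroup using (x∙yz≈y∙xz)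
open import Data.Product using (Σ; ∃; _×_; _,_; proj₁; proj₂)
open import Data.Sum using (_⊎_; inj₁; inj₂; reduce)
open import Function using (_∘_; id; Equivalence)
open import Relation.Binary.Definitions using (DecidableEquality)
open import Relation.Binary.PropositionalEquality using (_≡_; _≢_; refl; sym; trans; cong; cong₂; subst)
open import Relation.Nullary using (¬_; Dec; yes; no; does)
open import Relation.Nullary.Decidable using (map′; _×-dec_; _⊎-dec_; _→-dec_; dec-true; dec-false)

true≢false : true ≢ false
true≢false ()

does⇒ : ∀ {P : Set} (P? : Dec P) → does P? ≡ true → P
does⇒ (yes p) _ = p

∧-true⁻ : ∀ {a b} → a ∧ b ≡ true → a ≡ true × b ≡ true
∧-true⁻ {true} b≡true = refl , b≡true

∨-true⁻ : ∀ {a b} → a ∨ b ≡ true → a ≡ true ⊎ b ≡ true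
∨-true⁻ {true}  _       = inj₁ refl
∨-true⁻ {false} b≡true = inj₂ b≡true

module _ {A : Set} where

  count : (A → Bool) → List A → ℕ
  count p xs = length (filterᵇ p xs)

  count-mono : ∀ {p q : A → Bool} → (∀ x → p x ≡ true → q x ≡ true) →
               ∀ xs → count p xs ≤ count q xs
  count-mono p⇒q [] = z≤n
  count-mono {p} {q} p⇒q (x ∷ xs) with p x in px | q x in qx
  ... | true  | true  = s≤s (count-mono p⇒q xs)
  ... | true  | false with () ← trans (sym (p⇒q x px)) qx
  ... | false | true  = m≤n⇒m≤1+n (count-mono p⇒q xs)
  ... | false | false = count-mono p⇒q xs

  count-mono-< : ∀ {p q : A → Bool} → (∀ x → p x ≡ true → q x ≡ true) →
                 ∀ {y xs} → y ∈ xs → q y ≡ true → p y ≡ false → count p xs < count q xs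
  count-mono-< {p} {q} p⇒q {xs = x ∷ xs} (here refl) qy py rewrite qy | py =
    s≤s (count-mono p⇒q xs)
  count-mono-< {p} {q} p⇒q {xs = x ∷ xs} (there y∈xs) qy py with p x in px | q x in qx
  ... | true  | true  = s≤s (count-mono-< p⇒q y∈xs qy py)
  ... | true  | false with () ← trans (sym (p⇒q x px)) qx
  ... | false | true  = m≤n⇒m≤1+n (count-mono-< p⇒q y∈xs qy py)
  ... | false | false = count-mono-< p⇒q y∈xs qy py

  count-cong : ∀ {p q : A → Bool} → (∀ x → p x ≡ q x) → ∀ xs → count p xs ≡ count q xs
  count-cong p≗q xs = ≤-antisym (count-mono (λ x → trans (sym (p≗q x))) xs)
                                (count-mono (λ x → trans (p≗q x)) xs)

  count-++ : ∀ (p : A → Bool) xs ys → count p (xs ++ ys) ≡ count p xs + count p ys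
  count-++ p xs ys = trans (cong length (filter-++ _ xs ys)) (length-++ (filterᵇ p xs))

module _ {A B : Set} where

  count-map-const : ∀ (p : B → Bool) (f : A → B) {b} → (∀ x → p (f x) ≡ b) →
                    ∀ xs → count p (map f xs) ≡ (if b then length xs else 0)
  count-map-const p f {true}  pf≡b []       = refl
  count-map-const p f {false} pf≡b []       = refl
  count-map-const p f {b}     pf≡b (x ∷ xs) with p (f x) | pf≡b x
  count-map-const p f {true}  pf≡b (x ∷ xs) | true  | refl = cong suc (count-map-const p f pf≡b xs)
  count-map-const p f {false} pf≡b (x ∷ xs) | false | refl = count-map-const p f pf≡b xs

  count-concatMap : ∀ (p : B → Bool) (f : A → List B) xs →
                    count p (concatMap f xs) ≡ sum (map (count p ∘ f) xs)
  count-concatMap p f []       = refl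
  count-concatMap p f (x ∷ xs) =
    trans (count-++ p (f x) (concatMap f xs)) (cong (count p (f x) +_) (count-concatMap p f xs))

sum-zeros : ∀ n → sum (tabulate {n = n} (λ _ → 0)) ≡ 0
sum-zeros zero    = refl
sum-zeros (suc n) = sum-zeros n

sum-prefix≤ : ∀ {n} (g : Fin n → ℕ) {a b} → a ≤ b →
  sum (tabulate (λ j → if toℕ j <ᵇ a then suc (g j) else 0))
    ≤ b + sum (tabulate (λ j → if toℕ j <ᵇ b then g j else 0))
sum-prefix≤ {zero}  g         _          = z≤n
sum-prefix≤ {suc n} g {zero}  _          rewrite sum-zeros n = z≤n
sum-prefix≤ {suc n} g {suc a} {suc b} (s≤s a≤b) = s≤s (begin
  g zero + _       ≤⟨ +-monoʳ-≤ (g zero) (sum-prefix≤ (g ∘ suc) a≤b) ⟩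
  g zero + (b + _) ≡⟨ x∙yz≈y∙xz (g zero) b _ ⟩
  b + (g zero + _) ∎)
  where open ≤-Reasoning

module Finite {A : Set} (_≟_ : DecidableEquality A)
              (elems : List A) (∈-elems : ∀ x → x ∈ elems) where

  _⊆_ : (A → Bool) → (A → Bool) → Set
  X ⊆ Y = ∀ x → X x ≡ true → Y x ≡ true

  ∀? : {P : A → Set} → (∀ x → Dec (P x)) → Dec (∀ x → P x)
  ∀? P? = map′ (λ Ps x → All.lookup Ps (∈-elems x)) (λ P → All.tabulate λ {x} _ → P x)
               (all? P? elems)

  ∃? : {P : A → Set} → (∀ x → Dec (P x)) → Dec (∃ P)
  ∃? P? = map′ Any.satisfied (λ (x , Px) → Any.map (λ { refl → Px }) (∈-elems x))
               (any? P? elems)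

  _-_ : (A → Bool) → A → A → Bool
  (X - a) x = X x ∧ not (does (x ≟ a))

  -⊆ : ∀ X a → (X - a) ⊆ X
  -⊆ X a x = proj₁ ∘ ∧-true⁻

  -self : ∀ X a → (X - a) a ≡ false
  -self X a = trans (cong (λ b → X a ∧ not b) (dec-true (a ≟ a) refl)) (∧-zeroʳ (X a))

  -other : ∀ {X a x} → x ≢ a → X x ≡ true → (X - a) x ≡ true
  -other {a = a} {x = x} x≢a Xx = cong₂ _∧_ Xx (cong not (dec-false (x ≟ a) x≢a))

  -mono : ∀ {X Y} a → X ⊆ Y → (X - a) ⊆ (Y - a)
  -mono a X⊆Y x h = let Xx , x≢a = ∧-true⁻ h in cong₂ _∧_ (X⊆Y x Xx) x≢a

  _∖_ : (A → Bool) → (A → Bool) → A → Bool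
  (X ∖ Y) x = X x ∧ not (Y x)

  ∣_∣ : (A → Bool) → ℕ
  ∣ X ∣ = count X elems

  ∣-∣< : ∀ {X a} → X a ≡ true → ∣ X - a ∣ < ∣ X ∣
  ∣-∣< {X} {a} Xa = count-mono-< (-⊆ X a) (∈-elems a) Xa (-self X a)

  member : A → List A → Bool
  member x []       = false
  member x (y ∷ ys) = does (x ≟ y) ∨ member x ys

  member-∈ : ∀ {x xs} → x ∈ xs → member x xs ≡ true
  member-∈ {x} {_ ∷ ys} (here refl) = cong (_∨ member x ys) (dec-true (x ≟ x) refl)
  member-∈ {x} {y ∷ ys} (there x∈ys) =
    trans (cong (does (x ≟ y) ∨_) (member-∈ x∈ys)) (∨-zeroʳ _)

  _[_≔_] : (A → Bool) → A → Bool → A → Bool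
  (B [ a ≔ b ]) x = if does (x ≟ a) then b else B x

  glue : List A → (A → Bool) → (A → Bool) → A → Bool
  glue xs S B x = if member x xs then S x else B x

  glue-elems : ∀ S B x → glue elems S B x ≡ S x
  glue-elems S B x rewrite member-∈ (∈-elems x) = refl

  glue-∷ : ∀ a xs S B x → glue (a ∷ xs) S B x ≡ glue xs S (B [ a ≔ S a ]) x
  glue-∷ a xs S B x with x ≟ a | member x xs
  ... | yes refl | true  = refl
  ... | yes refl | false = refl
  ... | no _     | true  = refl
  ... | no _     | false = refl

  glue-absorb : ∀ a xs S B b x →
    glue (a ∷ xs) (glue xs S (B [ a ≔ b ])) B x ≡ glue xs S (B [ a ≔ b ]) x
  glue-absorb a xs S B b x with x ≟ a | member x xs
  ... | yes refl | true  = refl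
  ... | yes refl | false = refl
  ... | no _     | true  = refl
  ... | no _     | false = refl

  -- The values of S on elems are fixed one element at a time and recorded in B.
  module _ {Q : (A → Bool) → Set} (Q-resp : ∀ {S S'} → (∀ x → S x ≡ S' x) → Q S → Q S')
           (Q? : ∀ S → Dec (Q S)) where

    ∀-glue? : ∀ xs B → Dec (∀ S → Q (glue xs S B))
    ∀-glue? []       B = map′ (λ QB _ → QB) (λ Q∀ → Q∀ B) (Q? B)
    ∀-glue? (a ∷ xs) B = map′ split-on-a restrict-to-a
      (∀-glue? xs (B [ a ≔ true ]) ×-dec ∀-glue? xs (B [ a ≔ false ]))
      where
        split-on-a : (∀ S → Q (glue xs S (B [ a ≔ true ]))) × (∀ S → Q (glue xs S (B [ a ≔ false ])))
                   → ∀ S → Q (glue (a ∷ xs) S B)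
        split-on-a (Qt , Qf) S = Q-resp (sym ∘ glue-∷ a xs S B) (by-value (S a))
          where
            by-value : ∀ b → Q (glue xs S (B [ a ≔ b ]))
            by-value true  = Qt S
            by-value false = Qf S

        restrict-to-a : (∀ S → Q (glue (a ∷ xs) S B))
                      → (∀ S → Q (glue xs S (B [ a ≔ true ]))) × (∀ S → Q (glue xs S (B [ a ≔ false ])))
        restrict-to-a Q∀ = (λ S → Q-resp (glue-absorb a xs S B true)  (Q∀ _))
                         , (λ S → Q-resp (glue-absorb a xs S B false) (Q∀ _))

    ∀-subset? : Dec (∀ S → Q S)
    ∀-subset? = map′ (λ Q∀ S → Q-resp (glue-elems S _) (Q∀ S)) (λ Q∀ S → Q∀ _)
                     (∀-glue? elems (λ _ → false))

  module Minimal {P : (A → Bool) → Set} (P-up : ∀ {X Y} → X ⊆ Y → P X → P Y)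
                 (P? : ∀ X → Dec (P X)) where

    IsMinimal : (A → Bool) → Set
    IsMinimal X = P X × (∀ Y → Y ⊆ X → P Y → X ⊆ Y)

    Irreducible : (A → Bool) → A → Set
    Irreducible X a = ¬ P (X - a)

    irreducible-⊆ : ∀ {X Y a} → Y ⊆ X → Irreducible X a → Irreducible Y a
    irreducible-⊆ {a = a} Y⊆X ¬PX-a PY-a = ¬PX-a (P-up (-mono a Y⊆X) PY-a)

    drop : A → (A → Bool) → A → Bool
    drop a X with P? (X - a)
    ... | yes _ = X - a
    ... | no  _ = X

    drop-⊆ : ∀ a X → drop a X ⊆ X
    drop-⊆ a X with P? (X - a)
    ... | yes _ = -⊆ X a
    ... | no  _ = λ _ Xx → Xx

    drop-P : ∀ a X → P X → P (drop a X)
    drop-P a X PX with P? (X - a)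
    ... | yes PX-a = PX-a
    ... | no  _    = PX

    drop-irreducible : ∀ a X → drop a X a ≡ true → Irreducible (drop a X) a
    drop-irreducible a X a∈ with P? (X - a)
    ... | yes _    with () ← trans (sym a∈) (-self X a)
    ... | no ¬PX-a = ¬PX-a

    shrink : List A → (A → Bool) → A → Bool
    shrink []       X = X
    shrink (a ∷ as) X = shrink as (drop a X)

    shrink-⊆ : ∀ as X → shrink as X ⊆ X
    shrink-⊆ []       X         = λ _ Xx → Xx
    shrink-⊆ (a ∷ as) X x shrunk = drop-⊆ a X x (shrink-⊆ as (drop a X) x shrunk)

    shrink-P : ∀ as X → P X → P (shrink as X)
    shrink-P []       X PX = PX
    shrink-P (a ∷ as) X PX = shrink-P as (drop a X) (drop-P a X PX)

    shrink-irreducible : ∀ as X {a} → a ∈ as → shrink as X a ≡ true → Irreducible (shrink as X) a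
    shrink-irreducible (a ∷ as) X (here refl) a∈ =
      irreducible-⊆ (shrink-⊆ as (drop a X))
        (drop-irreducible a X (shrink-⊆ as (drop a X) a a∈))
    shrink-irreducible (b ∷ as) X (there a∈as) a∈ = shrink-irreducible as (drop b X) a∈as a∈

    minimal-⊆ : ∀ X → P X → Σ (A → Bool) λ Y → Y ⊆ X × IsMinimal Y
    minimal-⊆ X PX = Y , shrink-⊆ elems X , shrink-P elems X PX , below
      where
        Y : A → Bool
        Y = shrink elems X
        below : ∀ Z → Z ⊆ Y → P Z → Y ⊆ Z
        below Z Z⊆Y PZ x Yx with Z x in Zx
        ... | true  = refl
        ... | false = ⊥-elim (shrink-irreducible elems X (∈-elems x) Yx (P-up Z⊆Y-x PZ))
          where
            Z⊆Y-x : Z ⊆ (Y - x)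
            Z⊆Y-x z Zz = -other {Y} (λ { refl → true≢false (trans (sym Zz) Zx) }) (Z⊆Y z Zz)

module CaterpillarFacts (l : ℕ) (M : Fin l → ℕ) where
  open Caterpillar l M

  _≟ᵥ_ : DecidableEquality Vertex
  α i ≟ᵥ α j with i ≟ᶠ j
  ... | yes refl = yes refl
  ... | no  i≢j  = no λ { refl → i≢j refl }
  α _ ≟ᵥ β _ _ = no λ ()
  β _ _ ≟ᵥ α _ = no λ ()
  β i k ≟ᵥ β j k' with i ≟ᶠ j
  ... | no  i≢j  = no λ { refl → i≢j refl }
  ... | yes refl with k ≟ᶠ k'
  ...   | yes refl = yes refl
  ...   | no  k≢k' = no λ { refl → k≢k' refl }

  block : Fin l → List Vertex
  block i = α i ∷ map (β i) (allFin (M i))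

  ∈-allVertices : ∀ v → v ∈ allVertices
  ∈-allVertices (α i)   = ∈-concatMap⁺ block (Any.map (λ { refl → here refl }) (∈-allFin i))
  ∈-allVertices (β i k) =
    ∈-concatMap⁺ block (Any.map (λ { refl → there (∈-map⁺ (β i) (∈-allFin k)) }) (∈-allFin i))

  open Finite _≟ᵥ_ allVertices ∈-allVertices public

  edge? : ∀ u v → Dec (Edge u v)
  edge? (α i) (α j) = map′ (spine i j) (λ { (spine _ _ j≡1+i) → j≡1+i }) (toℕ j ≟ℕ suc (toℕ i))
  edge? (α i) (β j k) with i ≟ᶠ j
  ... | yes refl = yes (leaf i k)
  ... | no  i≢j  = no λ { (leaf _ _) → i≢j refl }
  edge? (β _ _) _ = no λ ()

  adj? : ∀ u v → Dec (Adj u v)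
  adj? u v = edge? u v ⊎-dec edge? v u

  walk-⊆ : ∀ {S S'} → S ⊆ S' → ∀ {u v} → Walk S u v → Walk S' u v
  walk-⊆ S⊆S' here           = here
  walk-⊆ S⊆S' (step a v∈S W) = step a (S⊆S' _ v∈S) (walk-⊆ S⊆S' W)

  walk-last-visit : ∀ {S x v} w → Walk S x v → Walk (S - w) x v ⊎ Walk (S - w) w v
  walk-last-visit w here = inj₁ here
  walk-last-visit {S} w (step {v = y} a y∈S W) with walk-last-visit w W
  ... | inj₂ W' = inj₂ W'
  ... | inj₁ W' with y ≟ᵥ w
  ...   | yes refl = inj₂ W'
  ...   | no  y≢w  = inj₁ (step a (-other {S} y≢w y∈S) W')

  FirstStep : VSet → Vertex → Vertex → Vertex → Set
  FirstStep S u v w = Adj u w × w ∈ₛ S × Walk (S - w) w v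

  first-step : ∀ {S u v} → Walk S u v → u ≢ v → ∃ (FirstStep S u v)
  first-step here                      u≢u = ⊥-elim (u≢u refl)
  first-step (step {v = w} a w∈S W) _   =
    w , a , w∈S , reduce (walk-last-visit w W)

  -- The first step of a walk can be taken to a vertex w never visited again, so the
  -- search recurses on the smaller set S - w.
  walk? : ∀ n S → ∣ S ∣ < n → ∀ u v → Dec (Walk S u v)
  walk? (suc n) S ∣S∣≤n u v with u ≟ᵥ v
  ... | yes refl = yes here
  ... | no  u≢v  = map′ (λ (w , a , w∈S , W) → step a w∈S (walk-⊆ (-⊆ S w) W))
                        (λ W → first-step W u≢v) (∃? first-step?)
    where
      first-step? : ∀ w → Dec (FirstStep S u v w)
      first-step? w with S w in w∈S
      ... | false = no λ { (_ , () , _) }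
      ... | true  = map′ (λ (a , W) → a , refl , W) (λ (a , _ , W) → a , W)
                         (adj? u w ×-dec walk? n (S - w) (<-≤-trans (∣-∣< w∈S) (≤-pred ∣S∣≤n)) w v)

  connected? : ∀ S → Dec (Connected S)
  connected? S = ∀? λ u → ∀? λ v →
    (S u ≟ᵇ true) →-dec (S v ≟ᵇ true) →-dec walk? (suc ∣ S ∣) S ≤-refl u v

  conEdge? : ∀ r S → Dec (ConEdge r S)
  conEdge? r S = (∣ S ∣ ≟ℕ suc r) ×-dec connected? S

  conEdge-resp : ∀ {r S S'} → (∀ v → S v ≡ S' v) → ConEdge r S → ConEdge r S'
  conEdge-resp {S = S} {S'} S≗S' (∣S∣≡1+r , conn) =
    trans (sym (count-cong S≗S' allVertices)) ∣S∣≡1+r ,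
    λ u v u∈S' v∈S' → walk-⊆ S⊆S' (conn u v (S'⊆S u u∈S') (S'⊆S v v∈S'))
    where
      S⊆S' : S ⊆ S'
      S⊆S' v = trans (sym (S≗S' v))
      S'⊆S : S' ⊆ S
      S'⊆S v = trans (S≗S' v)

  vertexCover? : ∀ r X → Dec (IsVertexCover r X)
  vertexCover? r X = ∀-subset? Q-resp Q?
    where
      Q : VSet → Set
      Q S = ConEdge r S → ∃ λ v → v ∈ₛ S × v ∈ₛ X
      Q-resp : ∀ {S S'} → (∀ v → S v ≡ S' v) → Q S → Q S'
      Q-resp S≗S' QS e with QS (conEdge-resp (sym ∘ S≗S') e)
      ... | v , v∈S , v∈X = v , trans (sym (S≗S' v)) v∈S , v∈X
      Q? : ∀ S → Dec (Q S)
      Q? S = conEdge? r S →-dec ∃? λ v → (S v ≟ᵇ true) ×-dec (X v ≟ᵇ true)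

  vertexCover-mono : ∀ {r X Y} → X ⊆ Y → IsVertexCover r X → IsVertexCover r Y
  vertexCover-mono X⊆Y cover S e with cover S e
  ... | v , v∈S , v∈X = v , v∈S , X⊆Y v v∈X

  minimalVertexCover-⊆ : ∀ r X → IsVertexCover r X →
                         Σ VSet λ C → C ⊆ X × IsMinimalVertexCover r C
  minimalVertexCover-⊆ r = Minimal.minimal-⊆ vertexCover-mono (vertexCover? r)

  pos : Vertex → ℕ
  pos (α i)   = toℕ i
  pos (β i _) = toℕ i

  leftOf : Fin l → VSet
  leftOf i v = pos v <ᵇ toℕ i

  adj-stays-left : ∀ i {S x z} → Adj x z → z ∈ₛ S → pos x < toℕ i → S (α i) ≡ false →
                   pos z < toℕ i
  adj-stays-left i (inj₁ (spine a b b≡1+a)) z∈S a<i αi∉S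
    with m≤n⇒m<n∨m≡n (subst (_≤ toℕ i) (sym b≡1+a) a<i)
  ... | inj₁ b<i = b<i
  ... | inj₂ b≡i with refl ← toℕ-injective b≡i = ⊥-elim (true≢false (trans (sym z∈S) αi∉S))
  adj-stays-left i (inj₁ (leaf _ _))         _ a<i _ = a<i
  adj-stays-left i (inj₂ (spine a b b≡1+a))  _ b<i _ =
    <-trans (subst (toℕ a <_) (sym b≡1+a) (n<1+n _)) b<i
  adj-stays-left i (inj₂ (leaf _ _))         _ a<i _ = a<i

  walk-stays-left : ∀ i {S x y} → Walk S x y → pos x < toℕ i → S (α i) ≡ false → pos y < toℕ i
  walk-stays-left i here                 x<i _     = x<i
  walk-stays-left i {S} (step a z∈S W) x<i αi∉S =
    walk-stays-left i W (adj-stays-left i {S} a z∈S x<i αi∉S) αi∉S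

  connected-⊆-leftOf : ∀ i {S u} → Connected S → u ∈ₛ S → pos u < toℕ i → S (α i) ≡ false →
                       S ⊆ leftOf i
  connected-⊆-leftOf i {S} conn u∈S u<i αi∉S v v∈S =
    Equivalence.to T-≡ (<⇒<ᵇ (walk-stays-left i {S} (conn _ v u∈S v∈S) u<i αi∉S))

  count-leftOf-block : ∀ i j →
    count (leftOf i) (block j) ≡ (if toℕ j <ᵇ toℕ i then suc (M j) else 0)
  count-leftOf-block i j with toℕ j <ᵇ toℕ i in j<i
  ... | true  = cong suc (trans (count-map-const (leftOf i) (β j) (λ _ → j<i) (allFin (M j)))
                                (length-tabulate id))
  ... | false = count-map-const (leftOf i) (β j) (λ _ → j<i) (allFin (M j))

  ∣leftOf∣≤ : ∀ {i t} → toℕ i ≤ toℕ t → ∣ leftOf i ∣ ≤ toℕ t + sumBefore t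
  ∣leftOf∣≤ {i} {t} i≤t = begin
    ∣ leftOf i ∣
      ≡⟨ count-concatMap (leftOf i) block (allFin l) ⟩
    sum (map (count (leftOf i) ∘ block) (allFin l))
      ≡⟨ cong sum (map-cong (count-leftOf-block i) (allFin l)) ⟩
    sum (map (λ j → if toℕ j <ᵇ toℕ i then suc (M j) else 0) (allFin l))
      ≡⟨ cong sum (map-tabulate {n = l} id _) ⟩
    sum (tabulate (λ j → if toℕ j <ᵇ toℕ i then suc (M j) else 0))
      ≤⟨ sum-prefix≤ M i≤t ⟩
    toℕ t + sum (tabulate (λ j → if toℕ j <ᵇ toℕ t then M j else 0))
      ≡⟨ cong (λ xs → toℕ t + sum xs) (map-tabulate {n = l} id _) ⟨
    toℕ t + sumBefore t
      ∎
    where open ≤-Reasoning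

  removeα⁻ : ∀ {C i v} → v ∈ₛ removeα C i → v ∈ₛ C × v ≢ α i
  removeα⁻ {C} {i} {α j} v∈ with i ≟ᶠ j | ∧-true⁻ {C (α j)} v∈
  ... | yes refl | _ , ()
  ... | no  i≢j  | v∈C , _ = v∈C , λ { refl → i≢j refl }
  removeα⁻ {v = β _ _} v∈ = v∈ , λ ()

  removeα⁺ : ∀ {C i v} → v ∈ₛ C → v ≢ α i → v ∈ₛ removeα C i
  removeα⁺ {i = i} {v = α j}   v∈C v≢αi =
    cong₂ _∧_ v∈C (cong not (dec-false (i ≟ᶠ j) λ { refl → v≢αi refl }))
  removeα⁺         {v = β _ _} v∈C _    = v∈C

  cutAt : Fin l → VSet → VSet
  cutAt i C v = does (v ≟ᵥ α i) ∨ (C v ∧ does (toℕ i ≤? pos v))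

  α∈cutAt : ∀ i C → α i ∈ₛ cutAt i C
  α∈cutAt i C = cong (_∨ (C (α i) ∧ does (toℕ i ≤? toℕ i))) (dec-true (α i ≟ᵥ α i) refl)

  cutAt⁺ : ∀ i C {v} → v ∈ₛ C → toℕ i ≤ pos v → v ∈ₛ cutAt i C
  cutAt⁺ i C {v} v∈C i≤v =
    trans (cong (does (v ≟ᵥ α i) ∨_) (cong₂ _∧_ v∈C (dec-true (toℕ i ≤? pos v) i≤v))) (∨-zeroʳ _)

  cutAt⁻ : ∀ i C {v} → v ∈ₛ cutAt i C → v ≡ α i ⊎ (v ∈ₛ C × toℕ i ≤ pos v)
  cutAt⁻ i C {v} v∈ with ∨-true⁻ {does (v ≟ᵥ α i)} v∈
  ... | inj₁ v≡αi    = inj₁ (does⇒ (v ≟ᵥ α i) v≡αi)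
  ... | inj₂ v∈right =
    let v∈C , i≤v = ∧-true⁻ {C v} v∈right in inj₂ (v∈C , does⇒ (toℕ i ≤? pos v) i≤v)

  cutAt-left : ∀ i C {v} → pos v < toℕ i → ¬ v ∈ₛ cutAt i C
  cutAt-left i C v<i v∈ with cutAt⁻ i C v∈
  ... | inj₁ refl      = <-irrefl refl v<i
  ... | inj₂ (_ , i≤v) = <⇒≱ v<i i≤v

  module _ (r : ℕ) where

    cutAt-cover : ∀ {i C} → ∣ leftOf i ∣ ≤ r → IsVertexCover r C → IsVertexCover r (cutAt i C)
    cutAt-cover {i} {C} ∣left∣≤r cover S e@(∣S∣≡1+r , conn) with cover S e
    ... | v , v∈S , v∈C with toℕ i ≤? pos v
    ...   | yes i≤v = v , v∈S , cutAt⁺ i C v∈C i≤v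
    ...   | no  i≰v with S (α i) in αi∈S
    ...     | true  = α i , αi∈S , α∈cutAt i C
    ...     | false = ⊥-elim (1+n≰n (subst (_≤ r) ∣S∣≡1+r (≤-trans ∣S∣≤∣left∣ ∣left∣≤r)))
      where
        ∣S∣≤∣left∣ : ∣ S ∣ ≤ ∣ leftOf i ∣
        ∣S∣≤∣left∣ = count-mono (connected-⊆-leftOf i {S} conn v∈S (≰⇒> i≰v) αi∈S) allVertices

    minimal-⊆-cutAt⇒A : ∀ {i' i C C'} → toℕ i' < toℕ i → A r i' C →
                         C' ⊆ cutAt i C → IsMinimalVertexCover r C' → A r i C'
    minimal-⊆-cutAt⇒A {i'} {i} {C} {C'} i'<i ((_ , minimal) , αi'∈C , _) C'⊆cut minC' =
      minC' , αi∈C' , λ j j<i → ¬-not (left-empty j<i) , λ k → ¬-not (left-empty j<i)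
      where
        left-empty : ∀ {v} → pos v < toℕ i → ¬ v ∈ₛ C'
        left-empty v<i v∈C' = cutAt-left i C v<i (C'⊆cut _ v∈C')

        αi∈C' : α i ∈ₛ C'
        αi∈C' with C' (α i) in αi∉C'
        ... | true  = refl
        ... | false = ⊥-elim (left-empty i'<i (minimal C' C'⊆C (proj₁ minC') (α i') αi'∈C))
          where
            C'⊆C : C' ⊆ C
            C'⊆C v v∈C' with cutAt⁻ i C (C'⊆cut v v∈C')
            ... | inj₁ refl      = ⊥-elim (true≢false (trans (sym v∈C') αi∉C'))
            ... | inj₂ (v∈C , _) = v∈C

  removeα-⊆-cutAt : ∀ {i' i C C'} → toℕ i' < toℕ i → C' ⊆ cutAt i C → removeα C' i ⊆ removeα C i'
  removeα-⊆-cutAt {i'} {i} {C} {C'} i'<i C'⊆cut v v∈ with removeα⁻ {C'} v∈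
  ... | v∈C' , v≢αi with cutAt⁻ i C (C'⊆cut v v∈C')
  ...   | inj₁ v≡αi        = ⊥-elim (v≢αi v≡αi)
  ...   | inj₂ (v∈C , i≤v) = removeα⁺ {C} {i'} v∈C λ { refl → <⇒≱ i'<i i≤v }

  ≟ₘ-cong : ∀ {μ μ'} → (∀ v → μ v ≡ μ' v) → ∀ ν → (μ ≟ₘ ν) ≡ (μ' ≟ₘ ν)
  ≟ₘ-cong μ≗μ' ν = foldr-cong (λ v b → cong (λ n → (n ≡ᵇ ν v) ∧ b) (μ≗μ' v)) refl allVertices

  indicator-split : ∀ {F H} → H ⊆ F → ∀ v → indicator F v ≡ indicator (F ∖ H) v + indicator H v
  indicator-split {F} {H} H⊆F v with H v in v∈H
  ... | true rewrite H⊆F v v∈H = refl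
  ... | false with F v
  ...   | true  = refl
  ...   | false = refl

  module Ideals {c ℓ} (K : Field c ℓ) where
    open PolyRing K
    open Field K using (_≈_; *-identityʳ; +-cong) renaming (refl to ≈-refl; sym to ≈-sym; trans to ≈-trans)

    _≋_ : Poly → Poly → Set (c ⊔ ℓ)
    _≋_ = Pointwise λ (a , μ) (b , ν) → a ≈ b × (∀ v → μ v ≡ ν v)

    coeff-cong : ∀ {p q} → p ≋ q → ∀ μ → coeff p μ ≈ coeff q μ
    coeff-cong [] μ = ≈-refl
    coeff-cong {(_ , m) ∷ _} {(_ , n) ∷ _} ((a≈b , m≗n) ∷ p≋q) μ
      rewrite ≟ₘ-cong m≗n μ with n ≟ₘ μ
    ... | true  = +-cong a≈b (coeff-cong p≋q μ)
    ... | false = coeff-cong p≋q μ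

    *x-split : ∀ g {F G H} → (∀ v → indicator F v ≡ indicator G v + indicator H v) →
               (g *ₚ x[ F ]) ≋ ((g *ₚ x[ G ]) *ₚ x[ H ])
    *x-split []            _     = []
    *x-split ((a , μ) ∷ g) split =
      (≈-sym (*-identityʳ _) , λ v → trans (cong (μ v +_) (split v)) (sym (+-assoc (μ v) _ _)))
      ∷ *x-split g split

    ∈⟨⟩-mono : ∀ {Gen Gen' : VSet → Set} → (∀ {F} → Gen F → ∃ λ H → Gen' H × H ⊆ F) →
               ∀ {f} → f ∈⟨ Gen ⟩ → f ∈⟨ Gen' ⟩
    ∈⟨⟩-mono {Gen} {Gen'} refine (gs , gens , f≈) =
      let gs' , gens' , sum≋ = regenerate gs gens
      in gs' , gens' , λ μ → ≈-trans (f≈ μ) (coeff-cong sum≋ μ)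
      where
        term : Poly × VSet → Poly
        term (g , F) = g *ₚ x[ F ]

        regenerate : ∀ gs → All (Gen ∘ proj₂) gs →
                     Σ (List (Poly × VSet)) λ gs' →
                       All (Gen' ∘ proj₂) gs' × sumₚ (map term gs) ≋ sumₚ (map term gs')
        regenerate []             []            = [] , [] , []
        regenerate ((g , F) ∷ gs) (genF ∷ gens) with refine genF | regenerate gs gens
        ... | H , genH , H⊆F | gs' , gens' , rest≋ =
          (g *ₚ x[ F ∖ H ] , H) ∷ gs' , genH ∷ gens' , ++⁺ (*x-split g (indicator-split H⊆F)) rest≋

    JGen-refine : ∀ {r i' i} → ∣ leftOf i ∣ ≤ r → toℕ i' < toℕ i →
                  ∀ {F} → JGen r i' F → ∃ λ H → JGen r i H × H ⊆ F
    JGen-refine {r} {i'} {i} ∣left∣≤r i'<i (C , C∈A , F≗) =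
      let C' , C'⊆cut , minC' =
            minimalVertexCover-⊆ r (cutAt i C) (cutAt-cover r ∣left∣≤r (proj₁ (proj₁ C∈A)))
      in removeα C' i , (C' , minimal-⊆-cutAt⇒A r i'<i C∈A C'⊆cut minC' , λ _ → refl) ,
         λ v v∈ → trans (F≗ v) (removeα-⊆-cutAt i'<i C'⊆cut v v∈)

lemma3p9 : ∀ {c ℓ} (K : Field c ℓ) (l : ℕ) (M : Fin l → ℕ) (t : Fin l) (mt r : ℕ)
    → 1 ≤ r
    → mt ≤ M t
    → suc r ≡ suc (toℕ t) + (Caterpillar.sumBefore l M t + mt)
    → ∀ (i' i : Fin l) → toℕ i' ≤ toℕ i → toℕ i ≤ toℕ t
    → ∀ (f : Caterpillar.PolyRing.Poly l M K)
    → Caterpillar.PolyRing._∈J[_,_] l M K f r i'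
    → Caterpillar.PolyRing._∈J[_,_] l M K f r i
lemma3p9 K l M t mt r _ _ r≡ i' i i'≤i i≤t f f∈J with m≤n⇒m<n∨m≡n i'≤i
... | inj₂ i'≡i with refl ← toℕ-injective i'≡i = f∈J
... | inj₁ i'<i = ∈⟨⟩-mono (JGen-refine ∣left∣≤r i'<i) {f} f∈J
  where
    open CaterpillarFacts l M
    open Ideals K
    ∣left∣≤r : ∣ leftOf i ∣ ≤ r
    ∣left∣≤r = ≤-trans (∣leftOf∣≤ i≤t)
                 (≤-trans (+-monoʳ-≤ (toℕ t) (m≤m+n _ mt)) (≤-reflexive (sym (suc-injective r≡))))
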